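{- Let $a$ be an integer. The pair $\{a,a\}$ is a Bhaskara pair if and only if $a=2n^6$ for some nonnegative integer $n$. In that case the integers $x=2n^4$ and $y=4n^9$ satisfy $a^2+a^2=x^3$ and $a^3+a^3=y^2$.
   Context: A Bhaskara pair is a pair $\{a,b\}$ of integers for which there exist integers $x,y$ with $a^2+b^2=x^3$ and $a^3+b^3=y^2$. A Bhaskara pair with $a=b$ is called a pair of Bhaskara twins. -}

module Defs where

open import Data.Integer using (ℤ; _+_; _*_; _^_)
open import Data.Product using (∃₂; _×_)
open import Relation.Binary.PropositionalEquality using (_≡_)

BhaskaraPair : ℤ → ℤ → Set
BhaskaraPair a b = ∃₂ λ (x y : ℤ) → (a ^ 2 + b ^ 2 ≡ x ^ 3) × (a ^ 3 + b ^ 3 ≡ y ^ 2)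

-- If 2A² = X³ and 2A³ = Y² over ℕ, then 2Y⁶ = 16A⁹ = A(X²)⁶. Dividing Y and X² by
-- their gcd gives 2u⁶ = Aw⁶ with u, w coprime, so w⁶ divides 2, forcing w = 1 and
-- A = 2u⁶. Negative a are excluded because 2a³ would be a negative square.
module Submission where

open import Defs
open import Data.Nat using (ℕ)
open import Data.Integer using (ℤ; +_; _+_; _*_; _^_)
open import Data.Product using (∃; _×_)
open import Function.Bundles using (_⇔_)
open import Relation.Binary.PropositionalEquality using (_≡_)

open import Data.Integer using (-[1+_]; +0; +[1+_]; ∣_∣)
open import Data.Integer.Properties using (pos-+; pos-*; abs-*)
import Data.Integer.Properties as ℤ
import Data.Integer.Solver as ℤ-Solver
import Data.Nat as ℕ
open import Data.Nat using (zero; suc; NonZero; z≤n; s≤s)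
open import Data.Nat.Properties
  using (*-cancelʳ-≡; *-assoc; *-comm; *-identityʳ; *-commutativeSemigroup; ^-zeroˡ; ^-*-assoc;
         ^-monoˡ-≤; m^n≢0; ≤-trans; <⇒≱; n<1⇒n≡0)
open import Data.Nat.Divisibility using (_∣_; divides; ∣-trans; ∣⇒≤; ∣1⇒≡1; 0∣⇒≡0)
open import Data.Nat.Coprimality using (Coprime; coprime-divisor; coprime-/gcd)
import Data.Nat.Coprimality as Coprime
open import Data.Nat.GCD using (gcd; gcd[m,n]∣m; gcd[m,n]∣n; gcd[m,n]≢0)
open import Data.Nat.DivMod using (_/_; m/n*n≡m)
import Data.Nat.Solver as ℕ-Solver
open import Algebra.Properties.CommutativeSemigroup *-commutativeSemigroup using (interchange)
open import Data.Product using (_,_; ∃₂)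
open import Data.Sum using (inj₂)
open import Data.Empty using (⊥-elim)
open import Relation.Nullary using (contradiction)
open import Function.Bundles using (mk⇔)
open import Relation.Binary.PropositionalEquality
  using (_≢_; refl; sym; trans; cong; module ≡-Reasoning)

open ≡-Reasoning

^-distrib-* : ∀ m n k → (m ℕ.* n) ℕ.^ k ≡ m ℕ.^ k ℕ.* n ℕ.^ k
^-distrib-* m n zero    = refl
^-distrib-* m n (suc k) = begin
  m ℕ.* n ℕ.* (m ℕ.* n) ℕ.^ k          ≡⟨ cong (m ℕ.* n ℕ.*_) (^-distrib-* m n k) ⟩
  m ℕ.* n ℕ.* (m ℕ.^ k ℕ.* n ℕ.^ k)    ≡⟨ interchange m n (m ℕ.^ k) (n ℕ.^ k) ⟩
  m ℕ.^ suc k ℕ.* n ℕ.^ suc k          ∎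

coprime-* : ∀ {m n o} → Coprime m n → Coprime m o → Coprime m (n ℕ.* o)
coprime-* {m} {n} m⊥n m⊥o {d} (d∣m , d∣no) = m⊥o (d∣m , coprime-divisor d⊥n d∣no)
  where
  d⊥n : Coprime d n
  d⊥n (e∣d , e∣n) = m⊥n (∣-trans e∣d d∣m , e∣n)

coprime-^ʳ : ∀ {m n} → Coprime m n → ∀ k → Coprime m (n ℕ.^ k)
coprime-^ʳ m⊥n zero    (_ , d∣1) = ∣1⇒≡1 d∣1
coprime-^ʳ m⊥n (suc k) = coprime-* m⊥n (coprime-^ʳ m⊥n k)

coprime-^ : ∀ {m n} → Coprime m n → ∀ k → Coprime (m ℕ.^ k) (n ℕ.^ k)
coprime-^ m⊥n k = Coprime.sym (coprime-^ʳ (Coprime.sym (coprime-^ʳ m⊥n k)) k)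

coprime⇒^∣ : ∀ {c a u w} k → Coprime u w → c ℕ.* u ℕ.^ k ≡ a ℕ.* w ℕ.^ k → w ℕ.^ k ∣ c
coprime⇒^∣ {c} {a} {u} k u⊥w eq =
  coprime-divisor (coprime-^ (Coprime.sym u⊥w) k) (divides a (trans (*-comm (u ℕ.^ k) c) eq))

divide-out-gcd : ∀ c a k y z .{{_ : NonZero z}} →
                 c ℕ.* y ℕ.^ k ≡ a ℕ.* z ℕ.^ k →
                 ∃₂ λ u w → Coprime u w × c ℕ.* u ℕ.^ k ≡ a ℕ.* w ℕ.^ k
divide-out-gcd c a k y z eq =
  y / g , z / g , coprime-/gcd y z ,
  *-cancelʳ-≡ _ _ (g ℕ.^ k)
    (trans (unscale c y (gcd[m,n]∣m y z)) (trans eq (sym (unscale a z (gcd[m,n]∣n y z)))))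
  where
  g = gcd y z
  instance
    g≢0 : NonZero g
    g≢0 = ℕ.≢-nonZero (gcd[m,n]≢0 y z (inj₂ (ℕ.≢-nonZero⁻¹ z)))
    g^k≢0 : NonZero (g ℕ.^ k)
    g^k≢0 = m^n≢0 g k
  unscale : ∀ x n → g ∣ n → x ℕ.* (n / g) ℕ.^ k ℕ.* g ℕ.^ k ≡ x ℕ.* n ℕ.^ k
  unscale x n g∣n = begin
    x ℕ.* (n / g) ℕ.^ k ℕ.* g ℕ.^ k      ≡⟨ *-assoc x _ _ ⟩
    x ℕ.* ((n / g) ℕ.^ k ℕ.* g ℕ.^ k)    ≡⟨ cong (x ℕ.*_) (sym (^-distrib-* (n / g) g k)) ⟩
    x ℕ.* (n / g ℕ.* g) ℕ.^ k            ≡⟨ cong (λ t → x ℕ.* t ℕ.^ k) (m/n*n≡m g∣n) ⟩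
    x ℕ.* n ℕ.^ k                        ∎

^∣-small⇒≡1 : ∀ m n {c} .{{_ : NonZero c}} → m ℕ.^ n ∣ c → c ℕ.< 2 ℕ.^ n → m ≡ 1
^∣-small⇒≡1 0             0       {c} _   c<1  = contradiction (n<1⇒n≡0 c<1) (ℕ.≢-nonZero⁻¹ c)
^∣-small⇒≡1 0             (suc n) {c} 0∣c _    = contradiction (0∣⇒≡0 0∣c) (ℕ.≢-nonZero⁻¹ c)
^∣-small⇒≡1 1             n           _   _    = refl
^∣-small⇒≡1 m@(suc (suc _)) n         m^n∣c c<2^n =
  contradiction (≤-trans (^-monoˡ-≤ n (s≤s (s≤s z≤n))) (∣⇒≤ m^n∣c)) (<⇒≱ c<2^n)

twin-powers-relation : ∀ a x y → a ℕ.^ 2 ℕ.+ a ℕ.^ 2 ≡ x ℕ.^ 3 → a ℕ.^ 3 ℕ.+ a ℕ.^ 3 ≡ y ℕ.^ 2 →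
                       2 ℕ.* y ℕ.^ 6 ≡ a ℕ.* (x ℕ.^ 2) ℕ.^ 6
twin-powers-relation a x y e₁ e₂ = begin
  2 ℕ.* y ℕ.^ 6                                 ≡⟨ cong (2 ℕ.*_) (^-*-assoc y 2 3) ⟨
  2 ℕ.* (y ℕ.^ 2) ℕ.^ 3                         ≡⟨ cong (λ t → 2 ℕ.* t ℕ.^ 3) e₂ ⟨
  2 ℕ.* (a ℕ.^ 3 ℕ.+ a ℕ.^ 3) ℕ.^ 3             ≡⟨ sixteen-a⁹ a ⟩
  a ℕ.* (a ℕ.^ 2 ℕ.+ a ℕ.^ 2) ℕ.^ 4             ≡⟨ cong (λ t → a ℕ.* t ℕ.^ 4) e₁ ⟩
  a ℕ.* (x ℕ.^ 3) ℕ.^ 4                         ≡⟨ cong (a ℕ.*_) (trans (^-*-assoc x 3 4) (sym (^-*-assoc x 2 6))) ⟩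
  a ℕ.* (x ℕ.^ 2) ℕ.^ 6                         ∎
  where
  open ℕ-Solver.+-*-Solver
  sixteen-a⁹ : ∀ a → 2 ℕ.* (a ℕ.^ 3 ℕ.+ a ℕ.^ 3) ℕ.^ 3 ≡ a ℕ.* (a ℕ.^ 2 ℕ.+ a ℕ.^ 2) ℕ.^ 4
  sixteen-a⁹ = solve 1 (λ a → con 2 :* (a :^ 3 :+ a :^ 3) :^ 3 := a :* (a :^ 2 :+ a :^ 2) :^ 4) refl

^-ratio⇒^-multiple : ∀ c a k y z .{{_ : NonZero c}} .{{_ : NonZero z}} →
                     c ℕ.< 2 ℕ.^ k → c ℕ.* y ℕ.^ k ≡ a ℕ.* z ℕ.^ k →
                     ∃ λ n → a ≡ c ℕ.* n ℕ.^ k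
^-ratio⇒^-multiple c a k y z c<2^k eq
  with u , w , u⊥w , e ← divide-out-gcd c a k y z eq
  with refl ← ^∣-small⇒≡1 w k (coprime⇒^∣ {a = a} k u⊥w e) c<2^k
  = u , sym (trans e (trans (cong (a ℕ.*_) (^-zeroˡ k)) (*-identityʳ a)))

twins⇒twice-sixth-power : ∀ a x y → a ℕ.^ 2 ℕ.+ a ℕ.^ 2 ≡ x ℕ.^ 3 → a ℕ.^ 3 ℕ.+ a ℕ.^ 3 ≡ y ℕ.^ 2 →
                          ∃ λ n → a ≡ 2 ℕ.* n ℕ.^ 6
twins⇒twice-sixth-power zero    x         y _  _  = 0 , refl
twins⇒twice-sixth-power (suc _) zero      y () _
twins⇒twice-sixth-power a       x@(suc _) y e₁ e₂ =
  ^-ratio⇒^-multiple 2 a 6 y (x ℕ.^ 2) (s≤s (s≤s (s≤s z≤n))) (twin-powers-relation a x y e₁ e₂)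

pos-^ : ∀ m n → + (m ℕ.^ n) ≡ (+ m) ^ n
pos-^ m zero    = refl
pos-^ m (suc n) = trans (pos-* m (m ℕ.^ n)) (cong (+ m *_) (pos-^ m n))

abs-^ : ∀ i n → ∣ i ^ n ∣ ≡ ∣ i ∣ ℕ.^ n
abs-^ i zero    = refl
abs-^ i (suc n) = trans (abs-* i (i ^ n)) (cong (∣ i ∣ ℕ.*_) (abs-^ i n))

twin-sum≡^⇒ℕ : ∀ a k i j → (+ a) ^ k + (+ a) ^ k ≡ i ^ j → a ℕ.^ k ℕ.+ a ℕ.^ k ≡ ∣ i ∣ ℕ.^ j
twin-sum≡^⇒ℕ a k i j eq = begin
  a ℕ.^ k ℕ.+ a ℕ.^ k              ≡⟨ cong ∣_∣ (pos-+ (a ℕ.^ k) (a ℕ.^ k)) ⟩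
  ∣ + (a ℕ.^ k) + + (a ℕ.^ k) ∣    ≡⟨ cong (λ t → ∣ t + t ∣) (pos-^ a k) ⟩
  ∣ (+ a) ^ k + (+ a) ^ k ∣        ≡⟨ cong ∣_∣ eq ⟩
  ∣ i ^ j ∣                        ≡⟨ abs-^ i j ⟩
  ∣ i ∣ ℕ.^ j                      ∎

-- Both sides normalise to integer constructors of opposite sign.
negative-twin-cube-sum≢square : ∀ m y → -[1+ m ] ^ 3 + -[1+ m ] ^ 3 ≢ y ^ 2
negative-twin-cube-sum≢square m +0       ()
negative-twin-cube-sum≢square m +[1+ k ] ()
negative-twin-cube-sum≢square m -[1+ k ] ()

bhaskara-twins⇒twice-sixth-power : ∀ a → BhaskaraPair a a → ∃ λ (n : ℕ) → a ≡ + 2 * (+ n) ^ 6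
bhaskara-twins⇒twice-sixth-power -[1+ m ] (_ , y , _ , e₂) = ⊥-elim (negative-twin-cube-sum≢square m y e₂)
bhaskara-twins⇒twice-sixth-power (+ a) (x , y , e₁ , e₂)
  with n , a≡2n⁶ ← twins⇒twice-sixth-power a ∣ x ∣ ∣ y ∣ (twin-sum≡^⇒ℕ a 2 x 3 e₁) (twin-sum≡^⇒ℕ a 3 y 2 e₂)
  = n , (begin
    + a                  ≡⟨ cong +_ a≡2n⁶ ⟩
    + (2 ℕ.* n ℕ.^ 6)    ≡⟨ pos-* 2 (n ℕ.^ 6) ⟩
    + 2 * + (n ℕ.^ 6)    ≡⟨ cong (+ 2 *_) (pos-^ n 6) ⟩
    + 2 * (+ n) ^ 6      ∎)

module _ where
  open ℤ-Solver.+-*-Solver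

  twin-square : ∀ b → (+ 2 * b) ^ 2 + (+ 2 * b) ^ 2 ≡ + 8 * b ^ 2
  twin-square = solve 1 (λ b → (con (+ 2) :* b) :^ 2 :+ (con (+ 2) :* b) :^ 2 := con (+ 8) :* b :^ 2) refl

  double-cube : ∀ d → (+ 2 * d) ^ 3 ≡ + 8 * d ^ 3
  double-cube = solve 1 (λ d → (con (+ 2) :* d) :^ 3 := con (+ 8) :* d :^ 3) refl

  twin-cube : ∀ b → (+ 2 * b) ^ 3 + (+ 2 * b) ^ 3 ≡ + 16 * b ^ 3
  twin-cube = solve 1 (λ b → (con (+ 2) :* b) :^ 3 :+ (con (+ 2) :* b) :^ 3 := con (+ 16) :* b :^ 3) refl

  quadruple-square : ∀ c → (+ 4 * c) ^ 2 ≡ + 16 * c ^ 2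
  quadruple-square = solve 1 (λ c → (con (+ 4) :* c) :^ 2 := con (+ 16) :* c :^ 2) refl

^-^-reassoc : ∀ (i : ℤ) m n p q → m ℕ.* n ≡ p ℕ.* q → (i ^ m) ^ n ≡ (i ^ p) ^ q
^-^-reassoc i m n p q eq = trans (ℤ.^-*-assoc i m n) (trans (cong (i ^_) eq) (sym (ℤ.^-*-assoc i p q)))

twin-square-sum : ∀ m → (+ 2 * m ^ 6) ^ 2 + (+ 2 * m ^ 6) ^ 2 ≡ (+ 2 * m ^ 4) ^ 3
twin-square-sum m = begin
  (+ 2 * m ^ 6) ^ 2 + (+ 2 * m ^ 6) ^ 2    ≡⟨ twin-square (m ^ 6) ⟩
  + 8 * (m ^ 6) ^ 2                        ≡⟨ cong (+ 8 *_) (^-^-reassoc m 6 2 4 3 refl) ⟩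
  + 8 * (m ^ 4) ^ 3                        ≡⟨ double-cube (m ^ 4) ⟨
  (+ 2 * m ^ 4) ^ 3                        ∎

twin-cube-sum : ∀ m → (+ 2 * m ^ 6) ^ 3 + (+ 2 * m ^ 6) ^ 3 ≡ (+ 4 * m ^ 9) ^ 2
twin-cube-sum m = begin
  (+ 2 * m ^ 6) ^ 3 + (+ 2 * m ^ 6) ^ 3    ≡⟨ twin-cube (m ^ 6) ⟩
  + 16 * (m ^ 6) ^ 3                       ≡⟨ cong (+ 16 *_) (^-^-reassoc m 6 3 9 2 refl) ⟩
  + 16 * (m ^ 9) ^ 2                       ≡⟨ quadruple-square (m ^ 9) ⟨
  (+ 4 * m ^ 9) ^ 2                        ∎

theorem2p5 : (a : ℤ) →
    (BhaskaraPair a a ⇔ ∃ λ (n : ℕ) → a ≡ + 2 * (+ n) ^ 6)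
    × ((n : ℕ) → a ≡ + 2 * (+ n) ^ 6 →
         (a ^ 2 + a ^ 2 ≡ (+ 2 * (+ n) ^ 4) ^ 3)
         × (a ^ 3 + a ^ 3 ≡ (+ 4 * (+ n) ^ 9) ^ 2))
theorem2p5 a = mk⇔ (bhaskara-twins⇒twice-sixth-power a) twice-sixth-power⇒bhaskara-twins , witnesses
  where
  witnesses : (n : ℕ) → a ≡ + 2 * (+ n) ^ 6 →
              (a ^ 2 + a ^ 2 ≡ (+ 2 * (+ n) ^ 4) ^ 3) × (a ^ 3 + a ^ 3 ≡ (+ 4 * (+ n) ^ 9) ^ 2)
  witnesses n refl = twin-square-sum (+ n) , twin-cube-sum (+ n)
  twice-sixth-power⇒bhaskara-twins : (∃ λ (n : ℕ) → a ≡ + 2 * (+ n) ^ 6) → BhaskaraPair a a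
  twice-sixth-power⇒bhaskara-twins (n , a≡2n⁶) = + 2 * (+ n) ^ 4 , + 4 * (+ n) ^ 9 , witnesses n a≡2n⁶
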